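{- Let $T$ be a rooted phylogeny and $X$ a triplet of its leaves. If $T|X$ is fully resolved, then $T|X$ is strictly induced by exactly one edge of $T$.
   Context: Rooted phylogeny: rooted tree with leaf set the taxon set, internal nodes with at least two children. $T|X$: minimal subtree of $T$ containing $X$ with all degree-two nodes except the root suppressed; for $X=\{a,b,c\}$ fully resolved, $T|X$ is one of $ab|c$, $ac|b$, $bc|a$, where $ab|c$ means the path from $a$ to $b$ does not meet the path from $c$ to the root. For a non-root node $v$ with parent $\mathrm{pa}(v)$, $T(v)$ is the subtree rooted at $v$ and $\overline{T(v)}$ the tree obtained by deleting $T(v)$ and the edge to $v$. The edge $\{v,\mathrm{pa}(v)\}$ induces $ab|c$ if $a,b$ are leaves of $T(v)$ and $c$ is a leaf of $\overline{T(v)}$; it strictly induces $ab|c$ if moreover $a$ and $b$ lie in the subtrees $T(v_1)$, $T(v_2)$ of two distinct children $v_1\ne v_2$ of $v$. -}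

module Defs where

open import Data.Nat using (ℕ; _≤_)
open import Data.List using (List; []; _∷_; _++_; length)
open import Data.List.Membership.Propositional using (_∈_; _∉_)
open import Data.List.Relation.Unary.Any using (index)
open import Data.List.Relation.Unary.Unique.Propositional using (Unique)
open import Data.Product using (Σ; _×_; ∃-syntax)
open import Data.Sum using (_⊎_)
open import Relation.Binary.PropositionalEquality using (_≡_)
open import Relation.Nullary using (¬_)

data Tree (A : Set) : Set where
  leaf : A → Tree A
  node : List (Tree A) → Tree A

module _ {A : Set} where

  mutual
    leaves : Tree A → List A
    leaves (leaf a)  = a ∷ []
    leaves (node ts) = leavesList ts

    leavesList : List (Tree A) → List A
    leavesList []       = []
    leavesList (t ∷ ts) = leaves t ++ leavesList ts

  -- Nodes of a tree, given as positions (paths from the root).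
  data Pos : Tree A → Set where
    root : ∀ {t} → Pos t
    down : ∀ {ts s} → s ∈ ts → Pos s → Pos (node ts)

  subAt : ∀ {t} → Pos t → Tree A
  subAt {t} root  = t
  subAt (down _ p) = subAt p

  -- Edges of a tree: an edge {v, pa(v)} is identified with its lower,
  -- non-root endpoint v, i.e. a position strictly below the root.
  data Edge : Tree A → Set where
    edge : ∀ {ts s} → s ∈ ts → Pos s → Edge (node ts)

  below : ∀ {t} → Edge t → Tree A
  below (edge _ p) = subAt p

  IsPhylogeny : Tree A → Set
  IsPhylogeny t =
    (∀ (p : Pos t) (ts : List (Tree A)) → subAt p ≡ node ts → 2 ≤ length ts)
    × Unique (leaves t)

  -- Node u lies on the path between leaves a and b:
  -- u is an ancestor-or-self of a or of b, and u is not a strict ancestor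
  -- of a node whose subtree contains both a and b (i.e. u is not above lca(a,b)).
  OnPath : ∀ {t} → A → A → Pos t → Set
  OnPath a b u =
    (a ∈ leaves (subAt u) ⊎ b ∈ leaves (subAt u))
    × ¬ (Σ (Edge (subAt u)) λ e → a ∈ leaves (below e) × b ∈ leaves (below e))

  OnRootPath : ∀ {t} → A → Pos t → Set
  OnRootPath c u = c ∈ leaves (subAt u)

  -- T|{a,b,c} = ab|c : the path from a to b does not meet the path from c to the root.
  Triplet : Tree A → A → A → A → Set
  Triplet t a b c = ¬ (Σ (Pos t) λ u → OnPath a b u × OnRootPath c u)

  Induces : (t : Tree A) → Edge t → A → A → A → Set
  Induces t e a b c =
    a ∈ leaves (below e) × b ∈ leaves (below e)
    × c ∈ leaves t × c ∉ leaves (below e)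

  StrictlyInduces : (t : Tree A) → Edge t → A → A → A → Set
  StrictlyInduces t e a b c =
    Induces t e a b c
    × Σ (List (Tree A)) λ us → below e ≡ node us
      × ∃[ x ] ∃[ y ] Σ (x ∈ us) λ i → Σ (y ∈ us) λ j →
          ¬ (index i ≡ index j) × a ∈ leaves x × b ∈ leaves y

-- The edges strictly inducing ab|c are the edges above a node whose children
-- separate a from b, i.e. above lca(a,b).  Such a node exists because a ≠ b,
-- and it is unique because, leaf labels being distinct, a leaf determines the
-- child containing it.  Since lca(a,b) lies on the path from a to b, the
-- triplet hypothesis ab|c says it is neither the root nor an ancestor of c,
-- so the edge above it exists and c lies outside it.
module Submission where

open import Defs
open import Data.List.Membership.Propositional using (_∈_)
open import Data.Product using (Σ; _×_)
open import Relation.Binary.PropositionalEquality using (_≡_; _≢_)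

open import Data.Empty using (⊥-elim)
open import Data.Fin.Properties using () renaming (_≟_ to _≟ᶠ_)
open import Data.List using (List; []; _∷_; _++_)
open import Data.List.Membership.Propositional.Properties using (∈-++⁻; ∈-++⁺ˡ; ∈-++⁺ʳ)
open import Data.List.Relation.Unary.All using (lookup)
open import Data.List.Relation.Unary.All.Properties using (++⁻ˡ)
open import Data.List.Relation.Unary.AllPairs using ([]; _∷_)
open import Data.List.Relation.Unary.Any using (here; there; index)
open import Data.List.Relation.Unary.Unique.Propositional using (Unique)
open import Data.Product using (∃; ∃-syntax; _,_; proj₂)
open import Data.Sum using (inj₁; inj₂)
open import Function using (_∘_)
open import Relation.Binary.PropositionalEquality using (refl; sym; trans; cong; setoid)
open import Relation.Nullary using (¬_; yes; no)
import Data.List.Membership.Setoid.Properties as SetoidMembership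

module _ {A : Set} where

  Unique-++⁻ˡ : ∀ (xs : List A) {ys} → Unique (xs ++ ys) → Unique xs
  Unique-++⁻ˡ []       _          = []
  Unique-++⁻ˡ (x ∷ xs) (x∉ ∷ xs!) = ++⁻ˡ xs x∉ ∷ Unique-++⁻ˡ xs xs!

  Unique-++⁻ʳ : ∀ (xs : List A) {ys} → Unique (xs ++ ys) → Unique ys
  Unique-++⁻ʳ []       ys!       = ys!
  Unique-++⁻ʳ (x ∷ xs) (_ ∷ xs!) = Unique-++⁻ʳ xs xs!

  Unique-++⇒disjoint : ∀ (xs : List A) {ys v} → Unique (xs ++ ys) → v ∈ xs → ¬ v ∈ ys
  Unique-++⇒disjoint (x ∷ xs) (x∉ ∷ _)   (here refl) v∈ys = lookup x∉ (∈-++⁺ʳ xs v∈ys) refl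
  Unique-++⇒disjoint (x ∷ xs) (_ ∷ xs!) (there v∈xs) v∈ys = Unique-++⇒disjoint xs xs! v∈xs v∈ys

  ∈-leavesList⁺ : ∀ {ts s} {a : A} → s ∈ ts → a ∈ leaves s → a ∈ leavesList ts
  ∈-leavesList⁺ {t ∷ _} (here refl) a∈s = ∈-++⁺ˡ a∈s
  ∈-leavesList⁺ {t ∷ _} (there s∈ts) a∈s = ∈-++⁺ʳ (leaves t) (∈-leavesList⁺ s∈ts a∈s)

  ∈-leavesList⁻ : ∀ ts {a : A} → a ∈ leavesList ts → ∃[ s ] s ∈ ts × a ∈ leaves s
  ∈-leavesList⁻ (t ∷ ts) a∈ts with ∈-++⁻ (leaves t) a∈ts
  ... | inj₁ a∈t = t , here refl , a∈t
  ... | inj₂ a∈rest with ∈-leavesList⁻ ts a∈rest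
  ...   | s , s∈ts , a∈s = s , there s∈ts , a∈s

  Unique-leaves-child : ∀ {ts s} → s ∈ ts → Unique (leavesList ts) → Unique (leaves s)
  Unique-leaves-child {t ∷ _} (here refl)  u = Unique-++⁻ˡ (leaves t) u
  Unique-leaves-child {t ∷ _} (there s∈ts) u = Unique-leaves-child s∈ts (Unique-++⁻ʳ (leaves t) u)

  ∈-leaves-subAt : ∀ {t} {a : A} (p : Pos t) → a ∈ leaves (subAt p) → a ∈ leaves t
  ∈-leaves-subAt root          a∈ = a∈
  ∈-leaves-subAt (down s∈ts p) a∈ = ∈-leavesList⁺ s∈ts (∈-leaves-subAt p a∈)

  Unique-leaves-subAt : ∀ {t} (p : Pos t) → Unique (leaves t) → Unique (leaves (subAt p))
  Unique-leaves-subAt root          u = u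
  Unique-leaves-subAt (down s∈ts p) u = Unique-leaves-subAt p (Unique-leaves-child s∈ts u)

  leaf-determines-child : ∀ {ts s s′} {a : A} → Unique (leavesList ts) →
    (m : s ∈ ts) (m′ : s′ ∈ ts) → a ∈ leaves s → a ∈ leaves s′ →
    _≡_ {A = ∃ (_∈ ts)} (s , m) (s′ , m′)
  leaf-determines-child {t ∷ _} u (here refl) (here refl) _ _ = refl
  leaf-determines-child {t ∷ _} u (here refl) (there m′) a∈t a∈s′ =
    ⊥-elim (Unique-++⇒disjoint (leaves t) u a∈t (∈-leavesList⁺ m′ a∈s′))
  leaf-determines-child {t ∷ _} u (there m) (here refl) a∈s a∈t =
    ⊥-elim (Unique-++⇒disjoint (leaves t) u a∈t (∈-leavesList⁺ m a∈s))
  leaf-determines-child {t ∷ _} u (there m) (there m′) a∈s a∈s′ =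
    cong (λ { (s , m) → s , there m }) (leaf-determines-child (Unique-++⁻ʳ (leaves t) u) m m′ a∈s a∈s′)

  -- r = lca(a, b): distinct children of r contain a and b.  This is verbatim the
  -- last component of StrictlyInduces, with r the subtree below the edge.
  Splits : Tree A → A → A → Set
  Splits r a b = Σ (List (Tree A)) λ us → r ≡ node us
    × ∃[ x ] ∃[ y ] Σ (x ∈ us) λ i → Σ (y ∈ us) λ j →
        ¬ (index i ≡ index j) × a ∈ leaves x × b ∈ leaves y

  splits⇒∈ˡ : ∀ {r a b} → Splits r a b → a ∈ leaves r
  splits⇒∈ˡ (_ , refl , _ , _ , i , _ , _ , a∈x , _) = ∈-leavesList⁺ i a∈x

  splits⇒∈ʳ : ∀ {r a b} → Splits r a b → b ∈ leaves r
  splits⇒∈ʳ (_ , refl , _ , _ , _ , j , _ , _ , b∈y) = ∈-leavesList⁺ j b∈y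

  splits⇒¬common-edge : ∀ {r a b} → Unique (leaves r) → Splits r a b →
    ¬ (Σ (Edge r) λ e → a ∈ leaves (below e) × b ∈ leaves (below e))
  splits⇒¬common-edge u (_ , refl , _ , _ , i , j , i≢j , a∈x , b∈y) (edge k q , a∈q , b∈q) =
    i≢j (trans (cong (index ∘ proj₂) (leaf-determines-child u i k a∈x (∈-leaves-subAt q a∈q)))
               (sym (cong (index ∘ proj₂) (leaf-determines-child u j k b∈y (∈-leaves-subAt q b∈q)))))

  splits⇒onPath : ∀ {t a b} → Unique (leaves t) → (p : Pos t) → Splits (subAt p) a b → OnPath a b p
  splits⇒onPath u p sp = inj₁ (splits⇒∈ˡ sp) , splits⇒¬common-edge (Unique-leaves-subAt p u) sp

  SplitNode : Tree A → A → A → Set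
  SplitNode t a b = Σ (Pos t) λ p → Splits (subAt p) a b

  -- Recursing into the child through its membership proof keeps the
  -- recursion structural.
  mutual
    splitNode : ∀ t {a b} → a ≢ b → a ∈ leaves t → b ∈ leaves t → SplitNode t a b
    splitNode (leaf _)  a≢b (here refl) (here refl) = ⊥-elim (a≢b refl)
    splitNode (node ts) a≢b a∈ts b∈ts
      with ∈-leavesList⁻ ts a∈ts | ∈-leavesList⁻ ts b∈ts
    ... | x , i , a∈x | y , j , b∈y with index i ≟ᶠ index j
    ...   | no i≢j = root , ts , refl , x , y , i , j , i≢j , a∈x , b∈y
    ...   | yes i≡j with SetoidMembership.index-injective (setoid (Tree A)) i j i≡j
    ...     | refl with splitNode-child i a≢b a∈x b∈y
    ...       | p , sp = down i p , sp

    splitNode-child : ∀ {ts x a b} → x ∈ ts → a ≢ b → a ∈ leaves x → b ∈ leaves x → SplitNode x a b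
    splitNode-child {t ∷ _} (here refl) = splitNode t
    splitNode-child (there x∈ts)        = splitNode-child x∈ts

  splitNode-unique : ∀ {t a b} → Unique (leaves t) → (p p′ : Pos t) →
    Splits (subAt p) a b → Splits (subAt p′) a b → p ≡ p′
  splitNode-unique u root root _ _ = refl
  splitNode-unique u root (down k q) sp sp′ =
    ⊥-elim (splits⇒¬common-edge u sp (edge k q , splits⇒∈ˡ sp′ , splits⇒∈ʳ sp′))
  splitNode-unique u (down k q) root sp sp′ =
    ⊥-elim (splits⇒¬common-edge u sp′ (edge k q , splits⇒∈ˡ sp , splits⇒∈ʳ sp))
  splitNode-unique u (down m q) (down m′ q′) sp sp′
    with leaf-determines-child u m m′ (∈-leaves-subAt q (splits⇒∈ˡ sp)) (∈-leaves-subAt q′ (splits⇒∈ˡ sp′))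
  ... | refl = cong (down m) (splitNode-unique (Unique-leaves-child m u) q q′ sp sp′)

  lower : ∀ {t : Tree A} → Edge t → Pos t
  lower (edge m q) = down m q

  lower-injective : ∀ {t : Tree A} {e e′ : Edge t} → lower e ≡ lower e′ → e ≡ e′
  lower-injective {e = edge _ _} {edge _ _} refl = refl

lemma13 : {A : Set} (t : Tree A) → IsPhylogeny t →
    (a b c : A) → a ∈ leaves t → b ∈ leaves t → c ∈ leaves t →
    a ≢ b → a ≢ c → b ≢ c →
    Triplet t a b c →
    Σ (Edge t) λ e → StrictlyInduces t e a b c
      × ((e′ : Edge t) → StrictlyInduces t e′ a b c → e′ ≡ e)
lemma13 t (_ , u) a b c a∈t b∈t c∈t a≢b _ _ ab∣c with splitNode t a≢b a∈t b∈t
... | root , sp = ⊥-elim (ab∣c (root , splits⇒onPath u root sp , c∈t))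
... | down m q , sp =
  edge m q , ((splits⇒∈ˡ sp , splits⇒∈ʳ sp , c∈t , c∉q) , sp) ,
  λ { e′@(edge _ _) (_ , sp′) → lower-injective (splitNode-unique u (lower e′) (down m q) sp′ sp) }
  where
    c∉q : ¬ c ∈ leaves (subAt q)
    c∉q c∈q = ab∣c (down m q , splits⇒onPath u (down m q) sp , c∈q)
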